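{- Suppose that $d, n \in \mathbb{N}^+$, $\pi_1, \ldots, \pi_s \in \mathrm{Sym}_n$ and $\mathrm{spt}(\pi_1, \ldots, \pi_s) = p$. Then \[ \frac{n^d + (p! - 1)(n-p)^d}{p!} \ \leq \ \mathrm{orb}^d(\pi_1, \ldots, \pi_s) \ \leq \ n^d - \frac{pn^{d-1}}{2}.\]
   Context: $\mathrm{Sym}_n$ is the symmetric group on $[n]=\{1,\dots,n\}$. For $\pi_1,\dots,\pi_s\in\mathrm{Sym}_n$, $\mathrm{spt}(\pi_1,\dots,\pi_s)$ is the number of $a\in[n]$ such that $g(a)\neq a$ for some $g\in\langle\pi_1,\dots,\pi_s\rangle$. $\mathrm{orb}^d(\pi_1,\dots,\pi_s)$ is the number of orbits of $\langle\pi_1,\dots,\pi_s\rangle$ on $[n]^d$ (ordered $d$-tuples) under the coordinatewise action $g(a_1,\dots,a_d)=(g(a_1),\dots,g(a_d))$. -}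

module Defs where

open import Data.Nat using (ℕ)
open import Data.Fin using (Fin)
open import Data.Bool using (Bool; true; false)
open import Data.List using (List; []; _∷_; length)
open import Data.List.Membership.Propositional using (_∈_)
open import Data.List.Relation.Unary.Any using (Any)
open import Data.List.Relation.Unary.AllPairs using (AllPairs)
open import Data.Product using (Σ; ∃; _×_)
open import Data.Fin.Permutation using (Permutation′; _⟨$⟩ʳ_; _⟨$⟩ˡ_)
open import Function.Bundles using (_⇔_)
open import Relation.Binary.PropositionalEquality using (_≡_; _≢_)
open import Relation.Nullary using (¬_)

-- A word in the generators π_1..π_s and their inverses:
-- (i , true) stands for π_i, (i , false) for π_i⁻¹.
Word : ℕ → Set
Word s = List (Fin s × Bool)

open import Data.Product using (_,_)

-- The element of ⟨π_1,…,π_s⟩ given by a word, acting on [n] = Fin n.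
-- Every element of the generated group is of this form (empty word = identity).
apply : ∀ {n s} → (Fin s → Permutation′ n) → Word s → Fin n → Fin n
apply π []               a = a
apply π ((i , true)  ∷ w) a = π i ⟨$⟩ʳ apply π w a
apply π ((i , false) ∷ w) a = π i ⟨$⟩ˡ apply π w a

Moved : ∀ {n s} → (Fin s → Permutation′ n) → Fin n → Set
Moved π a = ∃ λ w → apply π w a ≢ a

IsSpt : ∀ {n s} → (Fin s → Permutation′ n) → ℕ → Set
IsSpt {n} π p = Σ (List (Fin n)) λ S →
  length S ≡ p × AllPairs _≢_ S × (∀ a → (a ∈ S) ⇔ Moved π a)

Tuple : ℕ → ℕ → Set
Tuple n d = Fin d → Fin n

SameOrbit : ∀ {n s d} → (Fin s → Permutation′ n) → Tuple n d → Tuple n d → Set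
SameOrbit π t u = ∃ λ w → ∀ i → apply π w (t i) ≡ u i

-- orb^d(π_1,…,π_s) = k : there is a list of k tuples containing exactly one
-- representative of each orbit
IsOrb : ∀ {n s} → (Fin s → Permutation′ n) → (d : ℕ) → ℕ → Set
IsOrb {n} π d k = Σ (List (Tuple n d)) λ R →
  length R ≡ k
  × (∀ t → Any (λ r → SameOrbit π r t) R)
  × AllPairs (λ r r′ → ¬ SameOrbit π r r′) R

module Submission where

-- Split [n]^d into its k orbits O_j and count with indicator sums over tuples; orbit
-- invariant weights f satisfy  Σ_v f v = Σ_j |O_j| f(rep_j).
-- Lower bound: a group element is determined on the support S by the arrangement
-- (g s_1, …, g s_p) of S, so |O_j| ≤ p!; a tuple avoiding S is a one-point orbit, and
-- there are (n-p)^d of them (weight ∏ᵢ [vᵢ ∉ S]). Summing |O_j| + (p!-1)·#(such tuples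
-- in O_j) ≤ p! over j gives n^d + (p!-1)(n-p)^d ≤ p! k.
-- Upper bound: an orbit whose representative has its first coordinate in S has at least
-- two elements, and p n^(d-1) tuples have first coordinate in S (weight [v₁ ∈ S]);
-- summing 2 + |O_j|·[v₁ ∈ S] ≤ 2|O_j| over j gives 2k + p n^(d-1) ≤ 2 n^d.

open import Data.Bool using (true; false; not)
open import Data.Empty using (⊥-elim)
open import Data.Fin using (Fin; zero; suc; punchIn; punchOut)
open import Data.Fin.Permutation using (Permutation′; _⟨$⟩ʳ_; _⟨$⟩ˡ_; inverseˡ; inverseʳ)
open import Data.Fin.Properties using (_≟_; punchInᵢ≢i; punchIn-punchOut)
open import Data.List as List using (List; []; _∷_; _++_; length; filter)
open import Data.List.Membership.Propositional using (_∈_; _∉_)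
open import Data.List.Membership.Propositional.Properties using (∈-filter⁺; ∈-lookup)
open import Data.List.Properties using (filter-notAll)
open import Data.List.Relation.Unary.All as All using (All; []; _∷_)
import Data.List.Relation.Unary.All.Properties as Allₚ
open import Data.List.Relation.Unary.AllPairs using (AllPairs; []; _∷_)
open import Data.List.Relation.Unary.Any as Any using (Any; here; there)
open import Data.List.Relation.Unary.Any.Properties using (lookup-index)
open import Data.List.Relation.Unary.Unique.Propositional using (Unique)
import Data.List.Relation.Unary.Unique.Propositional.Properties as Unique
open import Data.Nat using (ℕ; zero; suc; _+_; _*_; _∸_; _^_; _≤_; z≤n; NonZero; _!)
open import Data.Nat.Properties hiding (_≟_)
open import Algebra.Properties.Semiring.Sum +-*-semiring
  using (sum; sum-cong-≗; sum-remove; ∑-comm; ∑-distrib-+; *-distribˡ-sum; *-distribʳ-sum)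
open import Data.Product using (∃; _×_; _,_)
open import Data.Sum using (_⊎_; inj₁; inj₂)
open import Data.Vec using (Vec; []; _∷_; head; lookup; tabulate; map; toList; fromList)
open import Data.Vec.Properties
  using (≡-dec; lookup-map; map-cong; lookup∘tabulate; tabulate∘lookup; tabulate-∘; tabulate-cong; toList-map; toList∘fromList)
open import Function using (_∘_)
open import Function.Bundles using (_⇔_; mk⇔; Equivalence)
open import Function.Related.TypeIsomorphisms using (¬-cong-⇔)
open import Relation.Binary.Definitions using (DecidableEquality; Symmetric; Transitive)
open import Relation.Binary.PropositionalEquality
open import Relation.Nullary using (¬_; Dec; yes; no; ¬?)

open import Defs

𝟙 : {P : Set} → Dec P → ℕ
𝟙 (yes _) = 1
𝟙 (no _)  = 0

𝟙-yes : {P : Set} (P? : Dec P) → P → 𝟙 P? ≡ 1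
𝟙-yes (yes _) _  = refl
𝟙-yes (no ¬p) p = ⊥-elim (¬p p)

𝟙-no : {P : Set} (P? : Dec P) → ¬ P → 𝟙 P? ≡ 0
𝟙-no (yes p) ¬p = ⊥-elim (¬p p)
𝟙-no (no _)  _  = refl

𝟙-cong : {P Q : Set} (P? : Dec P) (Q? : Dec Q) → P ⇔ Q → 𝟙 P? ≡ 𝟙 Q?
𝟙-cong (yes p) Q? P⇔Q = sym (𝟙-yes Q? (Equivalence.to P⇔Q p))
𝟙-cong (no ¬p) Q? P⇔Q = sym (𝟙-no Q? (¬p ∘ Equivalence.from P⇔Q))

𝟙-¬+𝟙 : {P : Set} (P? : Dec P) → 𝟙 (¬? P?) + 𝟙 P? ≡ 1
𝟙-¬+𝟙 (yes _) = refl
𝟙-¬+𝟙 (no _)  = refl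

sum-mono-≤ : ∀ {n} {f g : Fin n → ℕ} → (∀ i → f i ≤ g i) → sum f ≤ sum g
sum-mono-≤ {zero}  f≤g = z≤n
sum-mono-≤ {suc n} f≤g = +-mono-≤ (f≤g zero) (sum-mono-≤ (f≤g ∘ suc))

sum-const : ∀ n c → sum {n} (λ _ → c) ≡ n * c
sum-const zero    c = refl
sum-const (suc n) c = cong (c +_) (sum-const n c)

≤-sum : ∀ {n} (f : Fin n → ℕ) i → f i ≤ sum f
≤-sum {suc n} f i = ≤-trans (m≤m+n (f i) _) (≤-reflexive (sym (sum-remove f)))

+-≤-sum : ∀ {n} (f : Fin n → ℕ) {i j} → i ≢ j → f i + f j ≤ sum f
+-≤-sum {suc n} f {i} {j} i≢j = begin
  f i + f j                                 ≡⟨ cong (λ x → f i + f x) (punchIn-punchOut i≢j) ⟨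
  f i + f (punchIn i (punchOut i≢j))        ≤⟨ +-monoʳ-≤ (f i) (≤-sum (f ∘ punchIn i) (punchOut i≢j)) ⟩
  f i + sum (f ∘ punchIn i)                 ≡⟨ sum-remove f ⟨
  sum f                                     ∎
  where open ≤-Reasoning

sum-δ : ∀ {n} (i : Fin n) → sum (λ j → 𝟙 (i ≟ j)) ≡ 1
sum-δ {suc n} i = begin
  sum (λ j → 𝟙 (i ≟ j))                              ≡⟨ sum-remove (λ j → 𝟙 (i ≟ j)) ⟩
  𝟙 (i ≟ i) + sum (λ j → 𝟙 (i ≟ punchIn i j))        ≡⟨ cong₂ _+_ (𝟙-yes (i ≟ i) refl) (sum-cong-≗ off-diagonal) ⟩
  1 + sum {n} (λ _ → 0)                              ≡⟨ cong suc (trans (sum-const n 0) (*-zeroʳ n)) ⟩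
  1                                                  ∎
  where
  open ≡-Reasoning
  off-diagonal : ∀ j → 𝟙 (i ≟ punchIn i j) ≡ 0
  off-diagonal j = 𝟙-no (i ≟ punchIn i j) (punchInᵢ≢i i j ∘ sym)

module _ {n : ℕ} where
  open import Data.List.Membership.DecPropositional (_≟_ {n}) public using (_∈?_)

𝟙-∈-∷ : ∀ {n} {y : Fin n} {T} → y ∉ T → ∀ a → 𝟙 (a ∈? y ∷ T) ≡ 𝟙 (y ≟ a) + 𝟙 (a ∈? T)
𝟙-∈-∷ {y = y} {T} y∉T a with y ≟ a | a ∈? T
... | yes refl | yes a∈T = ⊥-elim (y∉T a∈T)
... | yes refl | no _    = 𝟙-yes _ (here refl)
... | no _     | yes a∈T = 𝟙-yes _ (there a∈T)
... | no y≢a   | no a∉T  = 𝟙-no _ λ { (here a≡y) → y≢a (sym a≡y) ; (there a∈T) → a∉T a∈T }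

sum-𝟙-∈ : ∀ {n} {T : List (Fin n)} → Unique T → sum (λ a → 𝟙 (a ∈? T)) ≡ length T
sum-𝟙-∈ {n} [] = trans (sum-const n 0) (*-zeroʳ n)
sum-𝟙-∈ {n} {y ∷ T} unique@(_ ∷ uniqueT) = begin
  sum (λ a → 𝟙 (a ∈? y ∷ T))                    ≡⟨ sum-cong-≗ (𝟙-∈-∷ (Unique.Unique[x∷xs]⇒x∉xs unique)) ⟩
  sum (λ a → 𝟙 (y ≟ a) + 𝟙 (a ∈? T))            ≡⟨ ∑-distrib-+ (λ a → 𝟙 (y ≟ a)) _ ⟩
  sum (λ a → 𝟙 (y ≟ a)) + sum (λ a → 𝟙 (a ∈? T)) ≡⟨ cong₂ _+_ (sum-δ y) (sum-𝟙-∈ uniqueT) ⟩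
  suc (length T)                                 ∎
  where open ≡-Reasoning

sum-𝟙-∉ : ∀ {n} {T : List (Fin n)} → Unique T → sum (λ a → 𝟙 (¬? (a ∈? T))) ≡ n ∸ length T
sum-𝟙-∉ {n} {T} unique = begin
  out                                          ≡⟨ m+n∸n≡m out (length T) ⟨
  out + length T ∸ length T                    ≡⟨ cong (λ x → out + x ∸ length T) (sum-𝟙-∈ unique) ⟨
  out + sum (λ a → 𝟙 (a ∈? T)) ∸ length T      ≡⟨ cong (_∸ length T) (∑-distrib-+ (λ a → 𝟙 (¬? (a ∈? T))) _) ⟨
  sum (λ a → 𝟙 (¬? (a ∈? T)) + 𝟙 (a ∈? T)) ∸ length T
    ≡⟨ cong (_∸ length T) (trans (sum-cong-≗ (λ a → 𝟙-¬+𝟙 (a ∈? T))) (trans (sum-const n 1) (*-identityʳ n))) ⟩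
  n ∸ length T                                 ∎
  where
  open ≡-Reasoning
  out = sum (λ a → 𝟙 (¬? (a ∈? T)))

sumᵛ : ∀ {n d} → (Vec (Fin n) d → ℕ) → ℕ
sumᵛ {d = zero}  f = f []
sumᵛ {d = suc d} f = sum λ x → sumᵛ λ v → f (x ∷ v)

sumᵛ-cong : ∀ {n d} {f g : Vec (Fin n) d → ℕ} → (∀ v → f v ≡ g v) → sumᵛ f ≡ sumᵛ g
sumᵛ-cong {d = zero}  f≗g = f≗g []
sumᵛ-cong {d = suc d} f≗g = sum-cong-≗ λ x → sumᵛ-cong λ v → f≗g (x ∷ v)

sumᵛ-mono-≤ : ∀ {n d} {f g : Vec (Fin n) d → ℕ} → (∀ v → f v ≤ g v) → sumᵛ f ≤ sumᵛ g
sumᵛ-mono-≤ {d = zero}  f≤g = f≤g []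
sumᵛ-mono-≤ {d = suc d} f≤g = sum-mono-≤ λ x → sumᵛ-mono-≤ λ v → f≤g (x ∷ v)

*-distribˡ-sumᵛ : ∀ {n d} c (f : Vec (Fin n) d → ℕ) → c * sumᵛ f ≡ sumᵛ (λ v → c * f v)
*-distribˡ-sumᵛ {d = zero}  c f = refl
*-distribˡ-sumᵛ {d = suc d} c f =
  trans (*-distribˡ-sum c (λ x → sumᵛ λ v → f (x ∷ v))) (sum-cong-≗ λ x → *-distribˡ-sumᵛ c (λ v → f (x ∷ v)))

*-distribʳ-sumᵛ : ∀ {n d} c (f : Vec (Fin n) d → ℕ) → sumᵛ f * c ≡ sumᵛ (λ v → f v * c)
*-distribʳ-sumᵛ c f =
  trans (*-comm (sumᵛ f) c) (trans (*-distribˡ-sumᵛ c f) (sumᵛ-cong λ v → *-comm c (f v)))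

sumᵛ-const : ∀ n d c → sumᵛ {n} {d} (λ _ → c) ≡ n ^ d * c
sumᵛ-const n zero    c = sym (*-identityˡ c)
sumᵛ-const n (suc d) c = begin
  sum {n} (λ _ → sumᵛ {n} {d} (λ _ → c))   ≡⟨ sum-cong-≗ {n} (λ _ → sumᵛ-const n d c) ⟩
  sum {n} (λ _ → n ^ d * c)                ≡⟨ sum-const n (n ^ d * c) ⟩
  n * (n ^ d * c)                          ≡⟨ *-assoc n (n ^ d) c ⟨
  n ^ suc d * c                            ∎
  where open ≡-Reasoning

sum-sumᵛ-comm : ∀ {k n d} (f : Fin k → Vec (Fin n) d → ℕ) →
  sum (λ j → sumᵛ (f j)) ≡ sumᵛ (λ v → sum (λ j → f j v))
sum-sumᵛ-comm {d = zero}  f = refl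
sum-sumᵛ-comm {d = suc d} f = trans (∑-comm λ j x → sumᵛ λ v → f j (x ∷ v))
  (sum-cong-≗ λ x → sum-sumᵛ-comm λ j v → f j (x ∷ v))

sumᵛ-comm : ∀ {n n′ m d} (f : Vec (Fin n) m → Vec (Fin n′) d → ℕ) →
  sumᵛ (λ a → sumᵛ (f a)) ≡ sumᵛ (λ v → sumᵛ (λ a → f a v))
sumᵛ-comm {m = zero}  f = refl
sumᵛ-comm {m = suc m} f = trans (sum-cong-≗ λ x → sumᵛ-comm λ a → f (x ∷ a))
  (sum-sumᵛ-comm λ x v → sumᵛ λ a → f (x ∷ a) v)

≤-sumᵛ : ∀ {n d} (f : Vec (Fin n) d → ℕ) v → f v ≤ sumᵛ f
≤-sumᵛ f []      = ≤-refl
≤-sumᵛ f (x ∷ v) = ≤-trans (≤-sumᵛ (λ v → f (x ∷ v)) v) (≤-sum _ x)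

+-≤-sumᵛ : ∀ {n d} (f : Vec (Fin n) d → ℕ) {u v} → u ≢ v → f u + f v ≤ sumᵛ f
+-≤-sumᵛ f {[]}    {[]}    u≢v = ⊥-elim (u≢v refl)
+-≤-sumᵛ f {x ∷ u} {y ∷ v} u≢v with x ≟ y
... | yes refl = ≤-trans (+-≤-sumᵛ (λ v → f (x ∷ v)) (u≢v ∘ cong (x ∷_))) (≤-sum _ x)
... | no x≢y   = ≤-trans (+-mono-≤ (≤-sumᵛ (λ u → f (x ∷ u)) u) (≤-sumᵛ (λ v → f (y ∷ v)) v))
                         (+-≤-sum _ x≢y)

infix 4 _≟ᵛ_
_≟ᵛ_ : ∀ {n d} → DecidableEquality (Vec (Fin n) d)
_≟ᵛ_ = ≡-dec _≟_

𝟙-∷-≟ᵛ : ∀ {n d} (x y : Fin n) (u v : Vec (Fin n) d) → 𝟙 (x ∷ u ≟ᵛ y ∷ v) ≡ 𝟙 (x ≟ y) * 𝟙 (u ≟ᵛ v)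
𝟙-∷-≟ᵛ x y u v with x ≟ y | u ≟ᵛ v
... | yes _ | yes _ = refl
... | yes _ | no _  = refl
... | no _  | yes _ = refl
... | no _  | no _  = refl

sumᵛ-δ : ∀ {n d} (u : Vec (Fin n) d) → sumᵛ (λ v → 𝟙 (u ≟ᵛ v)) ≡ 1
sumᵛ-δ []      = refl
sumᵛ-δ (y ∷ u) = begin
  sum (λ x → sumᵛ (λ v → 𝟙 (y ∷ u ≟ᵛ x ∷ v)))      ≡⟨ sum-cong-≗ (λ x → sumᵛ-cong (𝟙-∷-≟ᵛ y x u)) ⟩
  sum (λ x → sumᵛ (λ v → 𝟙 (y ≟ x) * 𝟙 (u ≟ᵛ v)))  ≡⟨ sum-cong-≗ (λ x → *-distribˡ-sumᵛ (𝟙 (y ≟ x)) (λ v → 𝟙 (u ≟ᵛ v))) ⟨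
  sum (λ x → 𝟙 (y ≟ x) * sumᵛ (λ v → 𝟙 (u ≟ᵛ v)))  ≡⟨ sum-cong-≗ (λ x → cong (𝟙 (y ≟ x) *_) (sumᵛ-δ u)) ⟩
  sum (λ x → 𝟙 (y ≟ x) * 1)                        ≡⟨ sum-cong-≗ (λ x → *-identityʳ (𝟙 (y ≟ x))) ⟩
  sum (λ x → 𝟙 (y ≟ x))                            ≡⟨ sum-δ y ⟩
  1                                                ∎
  where open ≡-Reasoning

sumᵛ-𝟙-≤-image : ∀ {n m d} {P : Vec (Fin n) d → Set} (P? : ∀ v → Dec (P v))
  (φ : Vec (Fin n) m → Vec (Fin n) d) (w : Vec (Fin n) m → ℕ) →
  (∀ {v} → P v → ∃ λ a → 1 ≤ w a × φ a ≡ v) →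
  sumᵛ (λ v → 𝟙 (P? v)) ≤ sumᵛ w
sumᵛ-𝟙-≤-image P? φ w cover = begin
  sumᵛ (λ v → 𝟙 (P? v))                           ≤⟨ sumᵛ-mono-≤ covered ⟩
  sumᵛ (λ v → sumᵛ (λ a → 𝟙 (φ a ≟ᵛ v) * w a))    ≡⟨ sumᵛ-comm (λ a v → 𝟙 (φ a ≟ᵛ v) * w a) ⟨
  sumᵛ (λ a → sumᵛ (λ v → 𝟙 (φ a ≟ᵛ v) * w a))    ≡⟨ sumᵛ-cong (λ a → *-distribʳ-sumᵛ (w a) (λ v → 𝟙 (φ a ≟ᵛ v))) ⟨
  sumᵛ (λ a → sumᵛ (λ v → 𝟙 (φ a ≟ᵛ v)) * w a)    ≡⟨ sumᵛ-cong (λ a → trans (cong (_* w a) (sumᵛ-δ (φ a))) (*-identityˡ (w a))) ⟩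
  sumᵛ w                                          ∎
  where
  open ≤-Reasoning
  covered : ∀ v → 𝟙 (P? v) ≤ sumᵛ (λ a → 𝟙 (φ a ≟ᵛ v) * w a)
  covered v with P? v
  ... | no _  = z≤n
  ... | yes p with cover p
  ...   | a , 1≤wa , refl = ≤-trans 1≤wa
          (≤-trans (≤-reflexive (trans (sym (*-identityˡ (w a))) (cong (_* w a) (sym (𝟙-yes (φ a ≟ᵛ φ a) refl)))))
                   (≤-sumᵛ (λ a′ → 𝟙 (φ a′ ≟ᵛ φ a) * w a′) a))

sumᵛ-head : ∀ {n d} (g : Fin n → ℕ) → sumᵛ {n} {suc d} (λ v → g (head v)) ≡ sum g * n ^ d
sumᵛ-head {n} {d} g = begin
  sum (λ x → sumᵛ {n} {d} (λ _ → g x))   ≡⟨ sum-cong-≗ (λ x → sumᵛ-const n d (g x)) ⟩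
  sum (λ x → n ^ d * g x)                ≡⟨ *-distribˡ-sum (n ^ d) g ⟨
  n ^ d * sum g                          ≡⟨ *-comm (n ^ d) (sum g) ⟩
  sum g * n ^ d                          ∎
  where open ≡-Reasoning

∏ᵛ : ∀ {n d} → (Fin n → ℕ) → Vec (Fin n) d → ℕ
∏ᵛ g []      = 1
∏ᵛ g (x ∷ v) = g x * ∏ᵛ g v

sumᵛ-∏ᵛ : ∀ {n} d (g : Fin n → ℕ) → sumᵛ {n} {d} (∏ᵛ g) ≡ sum g ^ d
sumᵛ-∏ᵛ zero    g = refl
sumᵛ-∏ᵛ (suc d) g = begin
  sum (λ x → sumᵛ {d = d} (λ v → g x * ∏ᵛ g v))  ≡⟨ sum-cong-≗ (λ x → *-distribˡ-sumᵛ {d = d} (g x) (∏ᵛ g)) ⟨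
  sum (λ x → g x * sumᵛ {d = d} (∏ᵛ g))          ≡⟨ sum-cong-≗ (λ x → cong (g x *_) (sumᵛ-∏ᵛ d g)) ⟩
  sum (λ x → g x * sum g ^ d)                    ≡⟨ *-distribʳ-sum (sum g ^ d) g ⟨
  sum g ^ suc d                                  ∎
  where open ≡-Reasoning

sum-fibres : ∀ {n d k} (φ : Vec (Fin n) d → Fin k) (f : Vec (Fin n) d → ℕ) →
  sum (λ j → sumᵛ (λ v → 𝟙 (φ v ≟ j) * f v)) ≡ sumᵛ f
sum-fibres φ f = begin
  sum (λ j → sumᵛ (λ v → 𝟙 (φ v ≟ j) * f v))   ≡⟨ sum-sumᵛ-comm (λ j v → 𝟙 (φ v ≟ j) * f v) ⟩
  sumᵛ (λ v → sum (λ j → 𝟙 (φ v ≟ j) * f v))   ≡⟨ sumᵛ-cong (λ v → *-distribʳ-sum (f v) (λ j → 𝟙 (φ v ≟ j))) ⟨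
  sumᵛ (λ v → sum (λ j → 𝟙 (φ v ≟ j)) * f v)   ≡⟨ sumᵛ-cong (λ v → trans (cong (_* f v) (sum-δ (φ v))) (*-identityˡ (f v))) ⟩
  sumᵛ f                                       ∎
  where open ≡-Reasoning

∏ᵛ-𝟙 : ∀ {n d} {P : Fin n → Set} (P? : ∀ a → Dec (P a)) (v : Vec (Fin n) d) →
  ∏ᵛ (𝟙 ∘ P?) v ≡ 0 ⊎ (∏ᵛ (𝟙 ∘ P?) v ≡ 1 × ∀ i → P (lookup v i))
∏ᵛ-𝟙 P? []      = inj₂ (refl , λ ())
∏ᵛ-𝟙 P? (x ∷ v) with P? x | ∏ᵛ-𝟙 P? v
... | no _   | _                = inj₁ refl
... | yes _  | inj₁ ∏≡0         = inj₁ (trans (+-identityʳ _) ∏≡0)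
... | yes px | inj₂ (∏≡1 , all) = inj₂ (trans (+-identityʳ _) ∏≡1 , λ { zero → px ; (suc i) → all i })

_∖_ : ∀ {n} → List (Fin n) → Fin n → List (Fin n)
T ∖ x = filter (λ y → ¬? (y ≟ x)) T

arrangement : ∀ {n m} → List (Fin n) → Vec (Fin n) m → ℕ
arrangement T []      = 1
arrangement T (x ∷ a) = 𝟙 (x ∈? T) * arrangement (T ∖ x) a

sumᵛ-arrangement≤ : ∀ {n} m {T : List (Fin n)} → Unique T → length T ≤ m → sumᵛ (arrangement {m = m} T) ≤ m !
sumᵛ-arrangement≤ zero    _ _ = ≤-refl
sumᵛ-arrangement≤ (suc m) {T} unique |T|≤1+m = begin
  sum (λ x → sumᵛ {d = m} (λ a → 𝟙 (x ∈? T) * arrangement (T ∖ x) a))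
    ≡⟨ sum-cong-≗ (λ x → *-distribˡ-sumᵛ {d = m} (𝟙 (x ∈? T)) (arrangement (T ∖ x))) ⟨
  sum (λ x → 𝟙 (x ∈? T) * sumᵛ {d = m} (arrangement (T ∖ x)))  ≤⟨ sum-mono-≤ shorter ⟩
  sum (λ x → 𝟙 (x ∈? T) * m !)                                 ≡⟨ *-distribʳ-sum (m !) (λ x → 𝟙 (x ∈? T)) ⟨
  sum (λ x → 𝟙 (x ∈? T)) * m !                                 ≡⟨ cong (_* m !) (sum-𝟙-∈ unique) ⟩
  length T * m !                                               ≤⟨ *-monoˡ-≤ (m !) |T|≤1+m ⟩
  suc m !                                                      ∎
  where
  open ≤-Reasoning
  shorter : ∀ x → 𝟙 (x ∈? T) * sumᵛ {d = m} (arrangement (T ∖ x)) ≤ 𝟙 (x ∈? T) * m !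
  shorter x with x ∈? T
  ... | no _    = z≤n
  ... | yes x∈T = *-monoʳ-≤ 1 (sumᵛ-arrangement≤ m (Unique.filter⁺ _ unique) (≤-pred (≤-trans |T∖x|<|T| |T|≤1+m)))
    where |T∖x|<|T| = filter-notAll (λ y → ¬? (y ≟ x)) T (Any.map (λ x≡y y≢x → y≢x (sym x≡y)) x∈T)

arrangement-≡1 : ∀ {n m} {T : List (Fin n)} (a : Vec (Fin n) m) →
  All (_∈ T) (toList a) → Unique (toList a) → arrangement T a ≡ 1
arrangement-≡1         []      _             _              = refl
arrangement-≡1 {T = T} (x ∷ a) (x∈T ∷ a⊆T) (x∉a ∷ unique) =
  cong₂ _*_ (𝟙-yes (x ∈? T) x∈T) (arrangement-≡1 a (All.zipWith ∈T∖x (a⊆T , x∉a)) unique)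
  where
  ∈T∖x : ∀ {y} → y ∈ T × x ≢ y → y ∈ T ∖ x
  ∈T∖x (y∈T , x≢y) = ∈-filter⁺ (λ y → ¬? (y ≟ x)) y∈T (x≢y ∘ sym)

lookup-fromList : ∀ {A : Set} (xs : List A) i → lookup (fromList xs) i ≡ List.lookup xs i
lookup-fromList (x ∷ xs) zero    = refl
lookup-fromList (x ∷ xs) (suc i) = lookup-fromList xs i

apart⇒lookup-injective : ∀ {A : Set} {_≈_ : A → A → Set} → Symmetric _≈_ →
  ∀ {xs} → AllPairs (λ x y → ¬ x ≈ y) xs → ∀ i j → List.lookup xs i ≈ List.lookup xs j → i ≡ j
apart⇒lookup-injective ≈-sym (_ ∷ _)       zero    zero    _   = refl
apart⇒lookup-injective ≈-sym (x≉ ∷ _)      zero    (suc j) x≈y = ⊥-elim (All.lookup x≉ (∈-lookup j) x≈y)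
apart⇒lookup-injective ≈-sym (x≉ ∷ _)      (suc i) zero    y≈x = ⊥-elim (All.lookup x≉ (∈-lookup i) (≈-sym y≈x))
apart⇒lookup-injective ≈-sym (_ ∷ apart)   (suc i) (suc j) eq  = cong suc (apart⇒lookup-injective ≈-sym apart i j eq)

module WordAction {n s : ℕ} (π : Fin s → Permutation′ n) where

  infixr 5 _·_ _·ᵛ_

  _·_ : Word s → Fin n → Fin n
  w · a = apply π w a

  _·ᵛ_ : ∀ {d} → Word s → Vec (Fin n) d → Vec (Fin n) d
  w ·ᵛ v = map (w ·_) v

  ·-++ : ∀ w w′ a → (w ++ w′) · a ≡ w · w′ · a
  ·-++ []                w′ a = refl
  ·-++ ((i , true)  ∷ w) w′ a = cong (π i ⟨$⟩ʳ_) (·-++ w w′ a)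
  ·-++ ((i , false) ∷ w) w′ a = cong (π i ⟨$⟩ˡ_) (·-++ w w′ a)

  inverse : Word s → Word s
  inverse []            = []
  inverse ((i , b) ∷ w) = inverse w ++ (i , not b) ∷ []

  inverse-· : ∀ w a → inverse w · w · a ≡ a
  inverse-· []                a = refl
  inverse-· ((i , true)  ∷ w) a =
    trans (·-++ (inverse w) _ _) (trans (cong (inverse w ·_) (inverseˡ (π i))) (inverse-· w a))
  inverse-· ((i , false) ∷ w) a =
    trans (·-++ (inverse w) _ _) (trans (cong (inverse w ·_) (inverseʳ (π i))) (inverse-· w a))

  ·-injective : ∀ w {a b} → w · a ≡ w · b → a ≡ b
  ·-injective w {a} {b} eq = trans (sym (inverse-· w a)) (trans (cong (inverse w ·_) eq) (inverse-· w b))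

  Moved-· : ∀ w {a} → Moved π a → Moved π (w · a)
  Moved-· w {a} (h , h·a≢a) = w ++ h ++ inverse w , h·a≢a ∘ ·-injective w ∘ trans (sym conjugate)
    where
    conjugate : (w ++ h ++ inverse w) · w · a ≡ w · h · a
    conjugate = trans (·-++ w _ _) (cong (w ·_) (trans (·-++ h _ _) (cong (h ·_) (inverse-· w a))))

  ¬Moved⇒fixed : ∀ {a} → ¬ Moved π a → ∀ w → w · a ≡ a
  ¬Moved⇒fixed {a} ¬moved w with w · a ≟ a
  ... | yes fixed = fixed
  ... | no moved  = ⊥-elim (¬moved (w , moved))

  ·ᵛ-fixed : ∀ {d} {v : Vec (Fin n) d} → (∀ i → ¬ Moved π (lookup v i)) → ∀ w → w ·ᵛ v ≡ v
  ·ᵛ-fixed {v = []}    _      w = refl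
  ·ᵛ-fixed {v = x ∷ v} ¬moved w = cong₂ _∷_ (¬Moved⇒fixed (¬moved zero) w) (·ᵛ-fixed (¬moved ∘ suc) w)

  ∏ᵛ-·ᵛ : ∀ {d} {g : Fin n → ℕ} → (∀ w a → g (w · a) ≡ g a) → ∀ w (v : Vec (Fin n) d) → ∏ᵛ g (w ·ᵛ v) ≡ ∏ᵛ g v
  ∏ᵛ-·ᵛ g-inv w []      = refl
  ∏ᵛ-·ᵛ g-inv w (x ∷ v) = cong₂ _*_ (g-inv w x) (∏ᵛ-·ᵛ g-inv w v)

  SameOrbit-sym : ∀ {d} → Symmetric (SameOrbit {d = d} π)
  SameOrbit-sym {x = t} (w , w·t≗u) = inverse w , λ i → trans (cong (inverse w ·_) (sym (w·t≗u i))) (inverse-· w (t i))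

  SameOrbit-trans : ∀ {d} → Transitive (SameOrbit {d = d} π)
  SameOrbit-trans {i = t} (w , w·t≗u) (w′ , w′·u≗v) =
    w′ ++ w , λ i → trans (·-++ w′ w (t i)) (trans (cong (w′ ·_) (w·t≗u i)) (w′·u≗v i))

  SameOrbit-·ᵛ : ∀ {d} w (v : Vec (Fin n) d) → SameOrbit π (lookup v) (lookup (w ·ᵛ v))
  SameOrbit-·ᵛ w v = w , λ i → sym (lookup-map i (w ·_) v)

module Support {n s : ℕ} (π : Fin s → Permutation′ n) {S : List (Fin n)}
  (unique : Unique S) (spt : ∀ a → (a ∈ S) ⇔ Moved π a) where

  open WordAction π

  ∉S⇒¬Moved : ∀ {a} → a ∉ S → ¬ Moved π a
  ∉S⇒¬Moved a∉S = a∉S ∘ Equivalence.from (spt _)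

  ·∈S⇔∈S : ∀ w a → (w · a ∈ S) ⇔ (a ∈ S)
  ·∈S⇔∈S w a = mk⇔ ·a∈S⇒a∈S (Equivalence.from (spt _) ∘ Moved-· w ∘ Equivalence.to (spt a))
    where
    ·a∈S⇒a∈S : w · a ∈ S → a ∈ S
    ·a∈S⇒a∈S w·a∈S with a ∈? S
    ... | yes a∈S = a∈S
    ... | no a∉S  = subst (_∈ S) (¬Moved⇒fixed (∉S⇒¬Moved a∉S) w) w·a∈S

  inS outS : Fin n → ℕ
  inS  a = 𝟙 (a ∈? S)
  outS a = 𝟙 (¬? (a ∈? S))

  inS-· : ∀ w a → inS (w · a) ≡ inS a
  inS-· w a = 𝟙-cong (w · a ∈? S) (a ∈? S) (·∈S⇔∈S w a)

  outS-· : ∀ w a → outS (w · a) ≡ outS a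
  outS-· w a = 𝟙-cong (¬? (w · a ∈? S)) (¬? (a ∈? S)) (¬-cong-⇔ (·∈S⇔∈S w a))

  -- A word acts on a point of S as dictated by the list of images of S (in the order
  -- of S), and trivially elsewhere; fill rebuilds the action from that list.
  fill : Vec (Fin n) (length S) → Fin n → Fin n
  fill a r with r ∈? S
  ... | yes r∈S = lookup a (Any.index r∈S)
  ... | no _    = r

  restriction : Word s → Vec (Fin n) (length S)
  restriction w = w ·ᵛ fromList S

  fill-restriction : ∀ w r → fill (restriction w) r ≡ w · r
  fill-restriction w r with r ∈? S
  ... | no r∉S  = sym (¬Moved⇒fixed (∉S⇒¬Moved r∉S) w)
  ... | yes r∈S = begin
    lookup (w ·ᵛ fromList S) (Any.index r∈S)   ≡⟨ lookup-map (Any.index r∈S) (w ·_) (fromList S) ⟩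
    w · lookup (fromList S) (Any.index r∈S)    ≡⟨ cong (w ·_) (lookup-fromList S (Any.index r∈S)) ⟩
    w · List.lookup S (Any.index r∈S)          ≡⟨ cong (w ·_) (lookup-index r∈S) ⟨
    w · r                                      ∎
    where open ≡-Reasoning

  arrangement-restriction : ∀ w → arrangement S (restriction w) ≡ 1
  arrangement-restriction w = arrangement-≡1 (restriction w)
    (subst (All (_∈ S)) (sym toList-restriction) (Allₚ.map⁺ (All.tabulate (Equivalence.from (·∈S⇔∈S w _)))))
    (subst Unique (sym toList-restriction) (Unique.map⁺ (·-injective w) unique))
    where
    toList-restriction : toList (restriction w) ≡ List.map (w ·_) S
    toList-restriction = trans (toList-map (w ·_) (fromList S)) (cong (List.map (w ·_)) (toList∘fromList S))

module Orbits {n s d : ℕ} (π : Fin s → Permutation′ n) (R : List (Tuple n d))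
  (cover : ∀ t → Any (λ r → SameOrbit π r t) R)
  (apart : AllPairs (λ r r′ → ¬ SameOrbit π r r′) R) where

  open WordAction π

  orbitOf : Vec (Fin n) d → Fin (length R)
  orbitOf v = Any.index (cover (lookup v))

  rep : Fin (length R) → Vec (Fin n) d
  rep j = tabulate (List.lookup R j)

  private
    SameOrbit-R-injective : ∀ i j → SameOrbit π (List.lookup R i) (List.lookup R j) → i ≡ j
    SameOrbit-R-injective = apart⇒lookup-injective SameOrbit-sym apart

  orbitOf-resp : ∀ {u v} → SameOrbit π (lookup u) (lookup v) → orbitOf u ≡ orbitOf v
  orbitOf-resp {u} {v} u∼v = SameOrbit-R-injective _ _
    (SameOrbit-trans (lookup-index (cover (lookup u)))
      (SameOrbit-trans u∼v (SameOrbit-sym (lookup-index (cover (lookup v))))))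

  orbitOf-·ᵛ : ∀ w v → orbitOf (w ·ᵛ v) ≡ orbitOf v
  orbitOf-·ᵛ w v = sym (orbitOf-resp {v} {w ·ᵛ v} (SameOrbit-·ᵛ w v))

  orbitOf-rep : ∀ j → orbitOf (rep j) ≡ j
  orbitOf-rep j with lookup-index (cover (lookup (rep j)))
  ... | w , w·r≗rep = SameOrbit-R-injective _ _ (w , λ i → trans (w·r≗rep i) (lookup∘tabulate (List.lookup R j) i))

  inOrbit : ∀ {v j} → orbitOf v ≡ j → ∃ λ w → w ·ᵛ rep j ≡ v
  inOrbit {v} refl with lookup-index (cover (lookup v))
  ... | w , w·r≗v = w , (begin
    map (w ·_) (tabulate r)   ≡⟨ tabulate-∘ (w ·_) r ⟨
    tabulate (λ i → w · r i)  ≡⟨ tabulate-cong w·r≗v ⟩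
    tabulate (lookup v)       ≡⟨ tabulate∘lookup v ⟩
    v                         ∎)
    where
    open ≡-Reasoning
    r = List.lookup R (orbitOf v)

  size : Fin (length R) → ℕ
  size j = sumᵛ (λ v → 𝟙 (orbitOf v ≟ j))

  sumᵛ-invariant : (f : Vec (Fin n) d → ℕ) → (∀ w v → f (w ·ᵛ v) ≡ f v) →
    sumᵛ f ≡ sum (λ j → size j * f (rep j))
  sumᵛ-invariant f f-inv = begin
    sumᵛ f                                                   ≡⟨ sum-fibres orbitOf f ⟨
    sum (λ j → sumᵛ (λ v → 𝟙 (orbitOf v ≟ j) * f v))        ≡⟨ sum-cong-≗ (λ j → sumᵛ-cong (constant-on-orbit j)) ⟩
    sum (λ j → sumᵛ (λ v → 𝟙 (orbitOf v ≟ j) * f (rep j)))  ≡⟨ sum-cong-≗ (λ j → *-distribʳ-sumᵛ (f (rep j)) (λ v → 𝟙 (orbitOf v ≟ j))) ⟨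
    sum (λ j → size j * f (rep j))                           ∎
    where
    open ≡-Reasoning
    constant-on-orbit : ∀ j v → 𝟙 (orbitOf v ≟ j) * f v ≡ 𝟙 (orbitOf v ≟ j) * f (rep j)
    constant-on-orbit j v with orbitOf v ≟ j
    ... | no _     = refl
    ... | yes v∈Oⱼ with inOrbit {v} v∈Oⱼ
    ...   | w , refl = cong (1 *_) (f-inv w (rep j))

  sum-size : sum size ≡ n ^ d
  sum-size = begin
    sum size                    ≡⟨ sum-cong-≗ (λ j → *-identityʳ (size j)) ⟨
    sum (λ j → size j * 1)      ≡⟨ sumᵛ-invariant (λ _ → 1) (λ _ _ → refl) ⟨
    sumᵛ {n} {d} (λ _ → 1)      ≡⟨ sumᵛ-const n d 1 ⟩
    n ^ d * 1                   ≡⟨ *-identityʳ (n ^ d) ⟩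
    n ^ d                       ∎
    where open ≡-Reasoning

  1≤size : ∀ j → 1 ≤ size j
  1≤size j = ≤-trans (≤-reflexive (sym (𝟙-yes (orbitOf (rep j) ≟ j) (orbitOf-rep j))))
                     (≤-sumᵛ (λ v → 𝟙 (orbitOf v ≟ j)) (rep j))

  2≤size : ∀ j i → Moved π (lookup (rep j) i) → 2 ≤ size j
  2≤size j i (w , moved) = begin
    1 + 1                                                      ≡⟨ cong₂ _+_ rep∈Oⱼ w·rep∈Oⱼ ⟨
    𝟙 (orbitOf (rep j) ≟ j) + 𝟙 (orbitOf (w ·ᵛ rep j) ≟ j)     ≤⟨ +-≤-sumᵛ (λ v → 𝟙 (orbitOf v ≟ j)) rep≢w·rep ⟩
    size j                                                     ∎
    where
    open ≤-Reasoning
    rep∈Oⱼ : 𝟙 (orbitOf (rep j) ≟ j) ≡ 1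
    rep∈Oⱼ = 𝟙-yes (orbitOf (rep j) ≟ j) (orbitOf-rep j)
    w·rep∈Oⱼ : 𝟙 (orbitOf (w ·ᵛ rep j) ≟ j) ≡ 1
    w·rep∈Oⱼ = 𝟙-yes (orbitOf (w ·ᵛ rep j) ≟ j) (trans (orbitOf-·ᵛ w (rep j)) (orbitOf-rep j))
    rep≢w·rep : rep j ≢ w ·ᵛ rep j
    rep≢w·rep eq = moved (sym (trans (cong (λ v → lookup v i) eq) (lookup-map i (w ·_) (rep j))))

  size≤1 : ∀ j → (∀ i → ¬ Moved π (lookup (rep j) i)) → size j ≤ 1
  -- O_j is the image of the one-point space Vec (Fin n) 0.
  size≤1 j fixed = sumᵛ-𝟙-≤-image (λ v → orbitOf v ≟ j) (λ (_ : Vec (Fin n) 0) → rep j) (λ _ → 1) singleton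
    where
    singleton : ∀ {v} → orbitOf v ≡ j → ∃ λ a → 1 ≤ 1 × rep j ≡ v
    singleton {v} v∈Oⱼ with inOrbit {v} v∈Oⱼ
    ... | w , refl = [] , ≤-refl , sym (·ᵛ-fixed fixed w)

module LowerBound {n s d : ℕ} (π : Fin s → Permutation′ n) {S : List (Fin n)}
  (unique : Unique S) (spt : ∀ a → (a ∈ S) ⇔ Moved π a) (R : List (Tuple n d))
  (cover : ∀ t → Any (λ r → SameOrbit π r t) R)
  (apart : AllPairs (λ r r′ → ¬ SameOrbit π r r′) R) where

  open WordAction π using (∏ᵛ-·ᵛ)
  open Support π unique spt
  open Orbits π R cover apart

  size≤p! : ∀ j → size j ≤ length S !
  size≤p! j = ≤-trans
    (sumᵛ-𝟙-≤-image (λ v → orbitOf v ≟ j) (λ a → map (fill a) (rep j)) (arrangement S) image)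
    (sumᵛ-arrangement≤ (length S) unique ≤-refl)
    where
    image : ∀ {v} → orbitOf v ≡ j → ∃ λ a → 1 ≤ arrangement S a × map (fill a) (rep j) ≡ v
    image {v} v∈Oⱼ with inOrbit {v} v∈Oⱼ
    ... | w , refl = restriction w , ≤-reflexive (sym (arrangement-restriction w)) , map-cong (fill-restriction w) (rep j)

  orbit-lower : ∀ j → size j + (length S ! ∸ 1) * (size j * ∏ᵛ outS (rep j)) ≤ length S !
  orbit-lower j with ∏ᵛ-𝟙 (λ a → ¬? (a ∈? S)) (rep j)
  ... | inj₁ ∏≡0 = begin
    size j + (P ∸ 1) * (size j * ∏ᵛ outS (rep j))  ≡⟨ cong (λ x → size j + (P ∸ 1) * (size j * x)) ∏≡0 ⟩
    size j + (P ∸ 1) * (size j * 0)                ≡⟨ cong (λ x → size j + (P ∸ 1) * x) (*-zeroʳ (size j)) ⟩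
    size j + (P ∸ 1) * 0                           ≡⟨ cong (size j +_) (*-zeroʳ (P ∸ 1)) ⟩
    size j + 0                                     ≡⟨ +-identityʳ (size j) ⟩
    size j                                         ≤⟨ size≤p! j ⟩
    P                                              ∎
    where
    open ≤-Reasoning
    P = length S !
  ... | inj₂ (∏≡1 , outside) = begin
    size j + (P ∸ 1) * (size j * ∏ᵛ outS (rep j))  ≡⟨ cong (λ x → size j + (P ∸ 1) * (size j * x)) ∏≡1 ⟩
    size j + (P ∸ 1) * (size j * 1)                ≤⟨ +-mono-≤ fixed-orbit (*-monoʳ-≤ (P ∸ 1) (*-monoˡ-≤ 1 fixed-orbit)) ⟩
    1 + (P ∸ 1) * 1                                ≡⟨ cong suc (*-identityʳ (P ∸ 1)) ⟩
    1 + (P ∸ 1)                                    ≡⟨ m+[n∸m]≡n (1≤n! (length S)) ⟩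
    P                                              ∎
    where
    open ≤-Reasoning
    P = length S !
    fixed-orbit : size j ≤ 1
    fixed-orbit = size≤1 j (∉S⇒¬Moved ∘ outside)

  lowerBound : n ^ d + (length S ! ∸ 1) * (n ∸ length S) ^ d ≤ length S ! * length R
  lowerBound = begin
    n ^ d + (P ∸ 1) * (n ∸ length S) ^ d
      ≡⟨ cong₂ (λ x y → x + (P ∸ 1) * y) sum-size (trans (sumᵛ-∏ᵛ d outS) (cong (_^ d) (sum-𝟙-∉ unique))) ⟨
    sum size + (P ∸ 1) * sumᵛ {d = d} (∏ᵛ outS)
      ≡⟨ cong (λ x → sum size + (P ∸ 1) * x) (sumᵛ-invariant (∏ᵛ outS) (∏ᵛ-·ᵛ outS-·)) ⟩
    sum size + (P ∸ 1) * sum (λ j → size j * ∏ᵛ outS (rep j))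
      ≡⟨ cong (sum size +_) (*-distribˡ-sum (P ∸ 1) (λ j → size j * ∏ᵛ outS (rep j))) ⟩
    sum size + sum (λ j → (P ∸ 1) * (size j * ∏ᵛ outS (rep j)))
      ≡⟨ ∑-distrib-+ size (λ j → (P ∸ 1) * (size j * ∏ᵛ outS (rep j))) ⟨
    sum (λ j → size j + (P ∸ 1) * (size j * ∏ᵛ outS (rep j)))
      ≤⟨ sum-mono-≤ orbit-lower ⟩
    sum {length R} (λ _ → P)
      ≡⟨ trans (sum-const (length R) P) (*-comm (length R) P) ⟩
    P * length R ∎
    where
    open ≤-Reasoning
    P = length S !

module UpperBound {n s d : ℕ} (π : Fin s → Permutation′ n) {S : List (Fin n)}
  (unique : Unique S) (spt : ∀ a → (a ∈ S) ⇔ Moved π a) (R : List (Tuple n (suc d)))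
  (cover : ∀ t → Any (λ r → SameOrbit π r t) R)
  (apart : AllPairs (λ r r′ → ¬ SameOrbit π r r′) R) where

  open WordAction π using (_·ᵛ_)
  open Support π unique spt
  open Orbits π R cover apart

  orbit-upper : ∀ j → 2 + size j * inS (head (rep j)) ≤ 2 * size j
  orbit-upper j with head (rep j) ∈? S
  ... | yes r∈S = begin
    2 + size j * 1         ≡⟨ cong (2 +_) (*-identityʳ (size j)) ⟩
    2 + size j             ≤⟨ +-monoˡ-≤ (size j) (2≤size j zero (Equivalence.to (spt _) r∈S)) ⟩
    size j + size j        ≡⟨ cong (size j +_) (+-identityʳ (size j)) ⟨
    2 * size j             ∎
    where open ≤-Reasoning
  ... | no _ = begin
    2 + size j * 0         ≡⟨ cong (2 +_) (*-zeroʳ (size j)) ⟩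
    2                      ≤⟨ *-monoʳ-≤ 2 (1≤size j) ⟩
    2 * size j             ∎
    where open ≤-Reasoning

  upperBound : 2 * length R + length S * n ^ d ≤ 2 * n ^ suc d
  upperBound = begin
    2 * length R + length S * n ^ d
      ≡⟨ cong₂ _+_ (trans (sum-const (length R) 2) (*-comm (length R) 2)) (cong (_* n ^ d) (sum-𝟙-∈ unique)) ⟨
    sum {length R} (λ _ → 2) + sum inS * n ^ d
      ≡⟨ cong (sum {length R} (λ _ → 2) +_) (trans (sym (sumᵛ-head {d = d} inS)) (sumᵛ-invariant (inS ∘ head) inS∘head-·ᵛ)) ⟩
    sum {length R} (λ _ → 2) + sum (λ j → size j * inS (head (rep j)))
      ≡⟨ ∑-distrib-+ (λ _ → 2) (λ j → size j * inS (head (rep j))) ⟨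
    sum (λ j → 2 + size j * inS (head (rep j)))
      ≤⟨ sum-mono-≤ orbit-upper ⟩
    sum (λ j → 2 * size j)
      ≡⟨ *-distribˡ-sum 2 size ⟨
    2 * sum size
      ≡⟨ cong (2 *_) sum-size ⟩
    2 * n ^ suc d ∎
    where
    open ≤-Reasoning
    inS∘head-·ᵛ : ∀ w (v : Vec (Fin n) (suc d)) → inS (head (w ·ᵛ v)) ≡ inS (head v)
    inS∘head-·ᵛ w (x ∷ v) = inS-· w x

lemma2p2 : (d n s : ℕ) → .{{NonZero d}} → .{{NonZero n}} →
    (π : Fin s → Permutation′ n) → (p : ℕ) → IsSpt π p →
    (k : ℕ) → IsOrb π d k →
    (n ^ d + (p ! ∸ 1) * (n ∸ p) ^ d ≤ p ! * k)
    × (2 * k + p * n ^ (d ∸ 1) ≤ 2 * n ^ d)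
lemma2p2 (suc d) n s π p (S , refl , unique , spt) k (R , refl , cover , apart) =
  LowerBound.lowerBound π unique spt R cover apart , UpperBound.upperBound π unique spt R cover apart
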